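{- Let $d \ge 0$ be an integer. Then: (1) $f(1,d) = \frac{2}{d+2}$ if $d$ is even, and $f(1,d) = \frac{2(d+2)}{(d+1)(d+3)}$ if $d$ is odd. (2) The equality $f(1,d) = \frac{\alpha_1(G)}{n(G)}$ is attained by the graph $G = J_{d+2}$ when $d$ is even, and by $G = (d+3)J_{d+1} \cup (d+1)J_{d+3}$ when $d$ is odd. (3) $f(1,d) \ge \frac{2}{d+2}$. (4) For every finite simple graph $G$ on $n$ vertices, $\alpha_1(G) \ge \frac{2n}{\lceil d(G)\rceil + 2}$.
   Context: For an integer $k \ge 0$, a $k$-independent set of a graph $G=(V,E)$ is a set $S \subseteq V$ such that the subgraph induced by $S$ has maximum degree at most $k$; $\alpha_k(G)$ is the maximum cardinality of a $k$-independent set of $G$. For a graph $G$, $n(G)$ is its number of vertices and $d(G) = \frac{1}{n(G)}\sum_v \deg(v)$ its average degree. For integers $d,k \ge 0$, $f(k,d) = \inf\left\{ \frac{\alpha_k(G)}{n(G)} : G \text{ is a finite simple graph with } d(G) \le d\right\}$. For an even integer $m$, $J_m$ denotes the complete graph $K_m$ minus a perfect matching. For a graph $F$ and integer $q$, $qF$ is the disjoint union of $q$ copies of $F$, and $\cup$ denotes disjoint union. -}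

module Defs where

open import Data.Bool using (Bool; true; false; if_then_else_; _∧_; not; _∨_)
open import Data.Nat as ℕ using (ℕ; zero; suc; _+_; _*_; _∸_; _≤ᵇ_; _⊔_; NonZero)
open import Data.Nat.Properties using ()
open import Data.Fin as Fin using (Fin; toℕ; _↑ˡ_; _↑ʳ_; splitAt)
open import Data.Sum using (_⊎_; inj₁; inj₂)
open import Data.List using (List; []; _∷_; map; allFin; foldr; _++_)
open import Data.Nat.ListAction using (sum)
open import Data.Vec using (Vec; []; _∷_; lookup)
open import Data.Integer as ℤ using (ℤ; +_)
open import Data.Rational as ℚ using (ℚ; _/_; _<_; _≤_)
open import Data.Product using (Σ; _×_; _,_; ∃-syntax)
open import Relation.Binary.PropositionalEquality using (_≡_)

record Graph : Set where
  field
    order     : ℕ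
    adj       : Fin order → Fin order → Bool
    adj-sym   : ∀ u v → adj u v ≡ adj v u
    adj-irr   : ∀ v → adj v v ≡ false
open Graph public

n : Graph → ℕ
n = order

count : ∀ {m} → (Fin m → Bool) → ℕ
count {m} p = sum (map (λ j → if p j then 1 else 0) (allFin m))

deg : (G : Graph) → Fin (order G) → ℕ
deg G v = count (adj G v)

degSum : Graph → ℕ
degSum G = sum (map (deg G) (allFin (order G)))

avgDeg : (G : Graph) → .{{NonZero (order G)}} → ℚ
avgDeg G = + degSum G / order G

-- a vertex subset is a Bool vector (true = in S)
VSet : Graph → Set
VSet G = Vec Bool (order G)

size : ∀ {m} → Vec Bool m → ℕ
size [] = 0
size (true ∷ s) = suc (size s)
size (false ∷ s) = size s

degIn : (G : Graph) → VSet G → Fin (order G) → ℕ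
degIn G S v = count (λ j → lookup S j ∧ adj G v j)

isKIndep : ℕ → (G : Graph) → VSet G → Bool
isKIndep k G S =
  foldr _∧_ true (map (λ v → not (lookup S v) ∨ (degIn G S v ≤ᵇ k)) (allFin (order G)))

allSubsets : (m : ℕ) → List (Vec Bool m)
allSubsets zero = [] ∷ []
allSubsets (suc m) = map (true ∷_) (allSubsets m) ++ map (false ∷_) (allSubsets m)

α : ℕ → Graph → ℕ
α k G = foldr _⊔_ 0
  (map (λ S → if isKIndep k G S then size S else 0) (allSubsets (order G)))

ratio : ℕ → (G : Graph) → .{{NonZero (order G)}} → ℚ
ratio k G = + α k G / order G

-- f(k,d) = inf { α_k(G)/n(G) : G finite simple graph, d(G) ≤ d }.
-- Since ℚ has no reals, "q = f(k,d)" is expressed as: q is the greatest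
-- lower bound of that set (graphs with n(G) ≥ 1).

AvgDegAtMost : (G : Graph) → .{{NonZero (order G)}} → ℕ → Set
AvgDegAtMost G d = avgDeg G ≤ (+ d / 1)

IsLowerBoundF : ℕ → ℕ → ℚ → Set
IsLowerBoundF k d q =
  (G : Graph) → .{{_ : NonZero (order G)}} → AvgDegAtMost G d → q ≤ ratio k G

IsF : ℕ → ℕ → ℚ → Set
IsF k d q =
  IsLowerBoundF k d q ×
  ((q' : ℚ) → q < q' →
    Σ Graph λ G → Σ (NonZero (order G)) λ nz →
      AvgDegAtMost G {{nz}} d × ratio k G {{nz}} < q')

_∪_ : Graph → Graph → Graph
G ∪ H = record
  { order = order G + order H
  ; adj = a
  ; adj-sym = sy
  ; adj-irr = ir
  }
  where
  a : Fin (order G + order H) → Fin (order G + order H) → Bool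
  a u v with splitAt (order G) u | splitAt (order G) v
  ... | inj₁ x | inj₁ y = adj G x y
  ... | inj₂ x | inj₂ y = adj H x y
  ... | inj₁ _ | inj₂ _ = false
  ... | inj₂ _ | inj₁ _ = false
  sy : ∀ u v → a u v ≡ a v u
  sy u v with splitAt (order G) u | splitAt (order G) v
  ... | inj₁ x | inj₁ y = adj-sym G x y
  ... | inj₂ x | inj₂ y = adj-sym H x y
  ... | inj₁ _ | inj₂ _ = _≡_.refl
  ... | inj₂ _ | inj₁ _ = _≡_.refl
  ir : ∀ v → a v v ≡ false
  ir v with splitAt (order G) v
  ... | inj₁ x = adj-irr G x
  ... | inj₂ x = adj-irr H x

emptyGraph : Graph
emptyGraph = record { order = 0 ; adj = λ () ; adj-sym = λ () ; adj-irr = λ () }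

copies : ℕ → Graph → Graph
copies zero F = emptyGraph
copies (suc q) F = F ∪ copies q F

-- J m : vertices Fin m, u ~ v iff ⌊u/2⌋ ≠ ⌊v/2⌋.  For even m this is
-- K_m minus the perfect matching {{0,1},{2,3},...}.
J : (m : ℕ) → Graph
J m = record
  { order = m
  ; adj = λ u v → not (half u ℕ.≡ᵇ half v)
  ; adj-sym = λ u v → sy (half u) (half v)
  ; adj-irr = λ v → ir (half v)
  }
  where
  half : Fin m → ℕ
  half u = toℕ u ℕ./ 2
  sy : ∀ a b → not (a ℕ.≡ᵇ b) ≡ not (b ℕ.≡ᵇ a)
  sy zero zero = _≡_.refl
  sy zero (suc b) = _≡_.refl
  sy (suc a) zero = _≡_.refl
  sy (suc a) (suc b) = sy a b
  ir : ∀ a → not (a ℕ.≡ᵇ a) ≡ false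
  ir zero = _≡_.refl
  ir (suc a) = ir a

module Submission where

-- For every c, every graph has a k-independent set S with
--   2(k+1)c·n ≤ (k+1)c(c+1)·|S| + Σ_v deg v.
-- Induction on c: while some vertex has degree at least (k+1)(c+1) it is deleted, which the
-- degree sum pays for; once all degrees are below (k+1)(c+1), Lovász's recolouring argument
-- (move a vertex with more than k neighbours of its colour to its rarest colour among its
-- neighbours, decreasing the number of monochromatic edges) splits the vertices into c+1
-- k-independent classes, the largest of which, combined with the set for c, gives the bound.
-- For k = 1 and c = ⌊d/2⌋ + 1 this yields (d+2)·α₁ ≥ 2n, and (d+1)(d+3)·α₁ ≥ 2(d+2)·n for odd d.
-- The bounds are attained because α₁(J_m) = 2 and α₁ is subadditive over disjoint unions.

open import Defs
open import Data.Nat using (ℕ; NonZero; _+_; _*_)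
open import Data.Nat.Divisibility using (_∣_)
open import Data.Integer as ℤ using (+_)
open import Data.Rational using (ℚ; _/_; ceiling)
open import Data.Product using (_×_)
open import Relation.Nullary using (¬_)
open import Relation.Binary.PropositionalEquality using (_≡_)

open import Data.Nat.Properties hiding (_≟_)
open import Algebra.Properties.CommutativeMonoid.Sum +-0-commutativeMonoid
  using (sum-syntax; sum-cong-≗; ∑-distrib-+; ∑-comm; sum-replicate-zero)
open import Data.Bool using (Bool; true; false; if_then_else_; _∧_; not; _∨_; T)
open import Data.Bool.Properties
  using (∧-zeroʳ; ∧-assoc; ∧-comm; ∧-conicalˡ; ∧-conicalʳ; T-∧; T-≡) renaming (_≟_ to _≟ᵇ_)
open import Data.Fin using (Fin; zero; suc; toℕ; _↑ˡ_; _↑ʳ_)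
open import Data.Fin.Properties using (_≟_; any?; toℕ<n; splitAt-↑ˡ; splitAt-↑ʳ)
open import Data.Integer.DivMod using ([n/d]*d≤n)
open import Data.Integer.GCD using (gcd)
import Data.Integer.Properties as ℤ
open import Data.List using ([]; _∷_; map; allFin; foldr; tabulate)
open import Data.List.Membership.Propositional using (_∈_)
open import Data.List.Membership.Propositional.Properties using (∈-map⁺; ∈-++⁺ˡ; ∈-++⁺ʳ; ∈-allFin)
open import Data.List.Properties using (map-tabulate; foldr-preservesᵇ; foldr-forcesᵇ; foldr-preservesᵒ)
import Data.List.Relation.Unary.All as All
import Data.List.Relation.Unary.All.Properties as All
import Data.List.Relation.Unary.Any as Any
open import Data.Nat as ℕ using (zero; suc; _≤_; _<_; z≤n; s≤s; _⊔_; _≤ᵇ_; _≡ᵇ_; _<ᵇ_)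
open import Data.Nat.DivMod using (m/n≡1+[m∸n]/n; m<n*o⇒m/o<n)
open import Data.Nat.Divisibility using (divides)
open import Data.Nat.Induction using (<-wellFounded)
open import Data.Nat.ListAction using () renaming (sum to listSum)
open import Data.Nat.Tactic.RingSolver using (solve; solve-∀)
open import Data.Product using (∃; _,_; uncurry)
open import Data.Rational as ℚ using (mkℚ; ↥_; ↧_; floor)
import Data.Rational.Properties as ℚ
open import Data.Rational.Unnormalised as ℚᵘ using (mkℚᵘ; *≤*)
import Data.Rational.Unnormalised.Properties as ℚᵘ
open import Data.Sum using (_⊎_; inj₁; inj₂; [_,_])
open import Data.Unit using (tt)
open import Data.Vec as Vec using (Vec; lookup)
open import Data.Vec.Properties using (lookup∘tabulate)
open import Function using (_∘_; Equivalence)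
open import Induction.WellFounded using (Acc; acc)
open import Relation.Nullary using (yes; no; does; contradiction)
open import Relation.Nullary.Decidable using (_×-dec_; dec-true)
open import Relation.Binary.PropositionalEquality hiding (J; [_])

-- The summand of Defs.count, so that count p unfolds to a sum of ind (p i).
ind : Bool → ℕ
ind b = if b then 1 else 0

private variable m : ℕ

∑-mono-≤ : {f g : Fin m → ℕ} → (∀ i → f i ≤ g i) → ∑[ i < m ] f i ≤ ∑[ i < m ] g i
∑-mono-≤ {zero}  _   = z≤n
∑-mono-≤ {suc m} f≤g = +-mono-≤ (f≤g zero) (∑-mono-≤ (f≤g ∘ suc))

∑-const : ∀ m a → ∑[ i < m ] a ≡ m * a
∑-const zero    a = refl
∑-const (suc m) a = cong (λ x → a + x) (∑-const m a)

∑-if : ∀ b (f : Fin m → ℕ) → ∑[ i < m ] (if b then f i else 0) ≡ (if b then ∑[ i < m ] f i else 0)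
∑-if {m} true  f = refl
∑-if {m} false f = sum-replicate-zero m

∑-δ : ∀ (i₀ : Fin m) (f : Fin m → ℕ) → ∑[ i < m ] (if does (i ≟ i₀) then f i else 0) ≡ f i₀
∑-δ {suc m} zero     f = trans (cong (λ x → f zero + x) (sum-replicate-zero m)) (+-identityʳ _)
∑-δ {suc m} (suc i₀) f = ∑-δ i₀ (f ∘ suc)

∑-ind-∧-δ : ∀ b (i₀ : Fin m) → ∑[ i < m ] ind (b ∧ does (i ≟ i₀)) ≡ ind b
∑-ind-∧-δ true  i₀ = ∑-δ i₀ (λ _ → 1)
∑-ind-∧-δ {m} false i₀ = sum-replicate-zero m

∑-≥-min : ∀ {c} (f : Fin (suc c) → ℕ) → ∃ λ k → suc c * f k ≤ ∑[ i < suc c ] f i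
∑-≥-min {zero}  f = zero , ≤-refl
∑-≥-min {suc c} f with ∑-≥-min (f ∘ suc)
... | k , bound with f zero ≤? f (suc k)
...   | yes f₀≤ = zero , +-monoʳ-≤ (f zero) (≤-trans (*-monoʳ-≤ (suc c) f₀≤) bound)
...   | no  f₀≰ = suc k , +-mono-≤ (<⇒≤ (≰⇒> f₀≰)) bound

∑-≤-max : ∀ {c} (f : Fin (suc c) → ℕ) → ∃ λ k → ∑[ i < suc c ] f i ≤ suc c * f k
∑-≤-max {zero}  f = zero , ≤-refl
∑-≤-max {suc c} f with ∑-≤-max (f ∘ suc)
... | k , bound with f (suc k) ≤? f zero
...   | yes f≤f₀ = zero , +-monoʳ-≤ (f zero) (≤-trans bound (*-monoʳ-≤ (suc c) f≤f₀))
...   | no  f≰f₀ = suc k , +-mono-≤ (<⇒≤ (≰⇒> f≰f₀)) bound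

does-≟-sym : ∀ (i j : Fin m) → does (i ≟ j) ≡ does (j ≟ i)
does-≟-sym i j with i ≟ j | j ≟ i
... | yes _    | yes _    = refl
... | no  _    | no  _    = refl
... | yes refl | no  i≢i  = contradiction refl i≢i
... | no  i≢i  | yes refl = contradiction refl i≢i

_∖_ : (Fin m → Bool) → Fin m → (Fin m → Bool)
(U ∖ i₀) i = not (does (i ≟ i₀)) ∧ U i

pairCount : (Fin m → Bool) → (Fin m → Fin m → Bool) → ℕ
pairCount {m} U R = ∑[ v < m ] ∑[ w < m ] ind (U v ∧ U w ∧ R v w)

pairCount-cong : ∀ {U} {R S : Fin m → Fin m → Bool} →
  (∀ v w → U v ≡ true → U w ≡ true → R v w ≡ S v w) → pairCount U R ≡ pairCount U S
pairCount-cong {U = U} R≗S = sum-cong-≗ λ v → sum-cong-≗ λ w → term v w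
  where
  term : ∀ v w → ind (U v ∧ U w ∧ _) ≡ ind (U v ∧ U w ∧ _)
  term v w with U v in Uv | U w in Uw
  ... | true  | true  = cong ind (R≗S v w Uv Uw)
  ... | true  | false = refl
  ... | false | _     = refl

module _ {U : Fin m → Bool} {R : Fin m → Fin m → Bool} {v₀ : Fin m}
         (U∋v₀ : U v₀ ≡ true) (R-irr : R v₀ v₀ ≡ false) where

  private
    row : ℕ
    row = ∑[ w < m ] ind (U w ∧ R v₀ w)

  pairTerm-split : ∀ v w → ind (U v ∧ U w ∧ R v w) ≡
    ind ((U ∖ v₀) v ∧ (U ∖ v₀) w ∧ R v w)
      + (if does (v ≟ v₀) then ind (U w ∧ R v w) else 0)
      + (if does (w ≟ v₀) then ind (U v ∧ R v w) else 0)
  pairTerm-split v w with v ≟ v₀ | w ≟ v₀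
  ... | yes refl | yes refl rewrite U∋v₀ | R-irr = refl
  ... | yes refl | no _     rewrite U∋v₀ = sym (+-identityʳ _)
  ... | no _     | yes refl rewrite U∋v₀ | ∧-zeroʳ (U v) = refl
  ... | no _     | no _     = sym (trans (+-identityʳ _) (+-identityʳ _))

  pairCount-remove : (∀ v w → R v w ≡ R w v) →
    pairCount U R ≡ pairCount (U ∖ v₀) R + 2 * ∑[ w < m ] ind (U w ∧ R v₀ w)
  pairCount-remove R-sym = begin
    pairCount U R
      ≡⟨ sum-cong-≗ (λ v → sum-cong-≗ (pairTerm-split v)) ⟩
    ∑[ v < m ] ∑[ w < m ] (a v w + b v w + c v w)
      ≡⟨ sum-cong-≗ (λ v → trans (∑-distrib-+ (λ w → a v w + b v w) (c v))
                                 (cong (_+ ∑[ w < m ] c v w) (∑-distrib-+ (a v) (b v)))) ⟩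
    ∑[ v < m ] (∑[ w < m ] a v w + ∑[ w < m ] b v w + ∑[ w < m ] c v w)
      ≡⟨ trans (∑-distrib-+ (λ v → ∑[ w < m ] a v w + ∑[ w < m ] b v w) (λ v → ∑[ w < m ] c v w))
               (cong (_+ ∑[ v < m ] ∑[ w < m ] c v w)
                     (∑-distrib-+ (λ v → ∑[ w < m ] a v w) (λ v → ∑[ w < m ] b v w))) ⟩
    pairCount (U ∖ v₀) R + ∑[ v < m ] ∑[ w < m ] b v w + ∑[ v < m ] ∑[ w < m ] c v w
      ≡⟨ cong₂ (λ x y → pairCount (U ∖ v₀) R + x + y) rowSum colSum ⟩
    pairCount (U ∖ v₀) R + row + row
      ≡⟨ +-assoc (pairCount (U ∖ v₀) R) row row ⟩
    pairCount (U ∖ v₀) R + (row + row)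
      ≡⟨ cong (λ x → pairCount (U ∖ v₀) R + x) (cong (λ x → row + x) (sym (+-identityʳ row))) ⟩
    pairCount (U ∖ v₀) R + 2 * row ∎
    where
    open ≡-Reasoning
    a b c : Fin m → Fin m → ℕ
    a v w = ind ((U ∖ v₀) v ∧ (U ∖ v₀) w ∧ R v w)
    b v w = if does (v ≟ v₀) then ind (U w ∧ R v w) else 0
    c v w = if does (w ≟ v₀) then ind (U v ∧ R v w) else 0
    rowSum : ∑[ v < m ] ∑[ w < m ] b v w ≡ row
    rowSum = trans (sum-cong-≗ (λ v → ∑-if (does (v ≟ v₀)) (λ w → ind (U w ∧ R v w))))
                   (∑-δ v₀ (λ v → ∑[ w < m ] ind (U w ∧ R v w)))
    colSum : ∑[ v < m ] ∑[ w < m ] c v w ≡ row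
    colSum = sum-cong-≗ λ v → trans (∑-δ v₀ (λ w → ind (U v ∧ R v w)))
                                    (cong (λ x → ind (U v ∧ x)) (R-sym v v₀))

card : (Fin m → Bool) → ℕ
card {m} U = ∑[ i < m ] ind (U i)

card-remove : ∀ (U : Fin m → Bool) i₀ → U i₀ ≡ true → card U ≡ suc (card (U ∖ i₀))
card-remove {m} U i₀ U∋i₀ = begin
  card U
    ≡⟨ sum-cong-≗ term ⟩
  ∑[ i < m ] (ind ((U ∖ i₀) i) + (if does (i ≟ i₀) then 1 else 0))
    ≡⟨ ∑-distrib-+ (ind ∘ (U ∖ i₀)) _ ⟩
  card (U ∖ i₀) + ∑[ i < m ] (if does (i ≟ i₀) then 1 else 0)
    ≡⟨ cong (λ x → card (U ∖ i₀) + x) (∑-δ i₀ (λ _ → 1)) ⟩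
  card (U ∖ i₀) + 1
    ≡⟨ +-comm (card (U ∖ i₀)) 1 ⟩
  suc (card (U ∖ i₀)) ∎
  where
  open ≡-Reasoning
  term : ∀ i → ind (U i) ≡ ind ((U ∖ i₀) i) + (if does (i ≟ i₀) then 1 else 0)
  term i with i ≟ i₀
  ... | yes refl rewrite U∋i₀ = refl
  ... | no _     = sym (+-identityʳ _)

∑-ind-witness : ∀ (p : Fin m → Bool) → 0 < ∑[ i < m ] ind (p i) → ∃ λ i → p i ≡ true
∑-ind-witness {suc m} p pos with p zero in p₀
... | true  = zero , p₀
... | false with ∑-ind-witness (p ∘ suc) pos
...   | i , pᵢ = suc i , pᵢ

module _ (G : Graph) where

  inducedDeg : (Fin (order G) → Bool) → Fin (order G) → ℕ
  inducedDeg U v = ∑[ w < order G ] ind (U w ∧ adj G v w)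

  inducedDegSum : (Fin (order G) → Bool) → ℕ
  inducedDegSum U = pairCount U (adj G)

  IsKIndependent : ℕ → (Fin (order G) → Bool) → Set
  IsKIndependent k U = ∀ v → U v ≡ true → inducedDeg U v ≤ k

  inducedDegSum-remove : ∀ U v → U v ≡ true → inducedDegSum U ≡ inducedDegSum (U ∖ v) + 2 * inducedDeg U v
  inducedDegSum-remove U v U∋v = pairCount-remove U∋v (adj-irr G v) (adj-sym G)

sum-map-allFin : ∀ m (f : Fin m → ℕ) → listSum (map f (allFin m)) ≡ ∑[ i < m ] f i
sum-map-allFin m f = trans (cong listSum (map-tabulate (λ i → i) f)) (sum-tabulate m f)
  where
  sum-tabulate : ∀ m (f : Fin m → ℕ) → listSum (tabulate f) ≡ ∑[ i < m ] f i
  sum-tabulate zero    f = refl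
  sum-tabulate (suc m) f = cong (λ x → f zero + x) (sum-tabulate m (f ∘ suc))

count≡∑ : ∀ {m} (p : Fin m → Bool) → count p ≡ ∑[ i < m ] ind (p i)
count≡∑ {m} p = sum-map-allFin m (ind ∘ p)

degSum≡inducedDegSum : ∀ G → degSum G ≡ inducedDegSum G (λ _ → true)
degSum≡inducedDegSum G =
  trans (sum-map-allFin (order G) (deg G)) (sum-cong-≗ λ v → count≡∑ (adj G v))

size≡card : ∀ {m} (S : Vec Bool m) → size S ≡ card (lookup S)
size≡card Vec.[]          = refl
size≡card (true Vec.∷ S)  = cong suc (size≡card S)
size≡card (false Vec.∷ S) = size≡card S

and-allFin⁺ : ∀ {m} (f : Fin m → Bool) → (∀ i → T (f i)) → T (foldr _∧_ true (map f (allFin m)))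
and-allFin⁺ {m} f Tf =
  foldr-preservesᵇ {P = T} (λ x y → Equivalence.from T-∧ (x , y)) tt (All.map⁺ (All.universal Tf (allFin m)))

and-allFin⁻ : ∀ {m} (f : Fin m → Bool) → T (foldr _∧_ true (map f (allFin m))) → ∀ i → T (f i)
and-allFin⁻ {m} f T∧ i =
  All.lookup (All.map⁻ (foldr-forcesᵇ {P = T} (λ x y → Equivalence.to T-∧) true _ T∧)) (∈-allFin i)

module _ (k : ℕ) (G : Graph) (S : Vec Bool (order G)) where

  isKIndep⇒IsKIndependent : T (isKIndep k G S) → IsKIndependent G k (lookup S)
  isKIndep⇒IsKIndependent T-indep v S∋v with and-allFin⁻ _ T-indep v
  ... | T-v rewrite S∋v | count≡∑ (λ j → lookup S j ∧ adj G v j) = ≤ᵇ⇒≤ _ k T-v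

  IsKIndependent⇒isKIndep : IsKIndependent G k (lookup S) → T (isKIndep k G S)
  IsKIndependent⇒isKIndep indep = and-allFin⁺ _ vertex
    where
    vertex : ∀ v → T (not (lookup S v) ∨ (degIn G S v ≤ᵇ k))
    vertex v with lookup S v in S∋v
    ... | false = tt
    ... | true rewrite count≡∑ (λ j → lookup S j ∧ adj G v j) = ≤⇒≤ᵇ (indep v S∋v)

∈-allSubsets : ∀ {m} (S : Vec Bool m) → S ∈ allSubsets m
∈-allSubsets Vec.[]          = Any.here refl
∈-allSubsets (true Vec.∷ S)  = ∈-++⁺ˡ (∈-map⁺ (true Vec.∷_) (∈-allSubsets S))
∈-allSubsets (false Vec.∷ S) = ∈-++⁺ʳ _ (∈-map⁺ (false Vec.∷_) (∈-allSubsets S))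

module _ {k : ℕ} (G : Graph) where

  IsKIndependent-resp-≗ : ∀ {U V} → U ≗ V → IsKIndependent G k U → IsKIndependent G k V
  IsKIndependent-resp-≗ U≗V indep v V∋v =
    subst (_≤ k) (sum-cong-≗ λ w → cong (λ b → ind (b ∧ adj G v w)) (U≗V w))
          (indep v (trans (U≗V v) V∋v))

  α-greatest : ∀ U → IsKIndependent G k U → card U ≤ α k G
  α-greatest U indep = foldr-preservesᵒ {P = card U ≤_}
    (λ x y → [ m≤n⇒m≤n⊔o y , m≤n⇒m≤o⊔n x ]) 0 _
    (inj₂ (Any.map (λ { refl → candidate }) (∈-map⁺ _ (∈-allSubsets S))))
    where
    S = Vec.tabulate U
    U≗S : U ≗ lookup S
    U≗S i = sym (lookup∘tabulate U i)
    candidate : card U ≤ (if isKIndep k G S then size S else 0)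
    candidate
      rewrite Equivalence.to T-≡ (IsKIndependent⇒isKIndep k G S (IsKIndependent-resp-≗ U≗S indep))
            | size≡card S = ≤-reflexive (sum-cong-≗ (cong ind ∘ U≗S))

  α-least : ∀ {B} → (∀ U → IsKIndependent G k U → card U ≤ B) → α k G ≤ B
  α-least {B} bound =
    foldr-preservesᵇ {P = _≤ B} {f = _⊔_} ⊔-lub z≤n (All.map⁺ (All.universal candidate (allSubsets (order G))))
    where
    candidate : ∀ S → (if isKIndep k G S then size S else 0) ≤ B
    candidate S with isKIndep k G S in indep
    ... | false = z≤n
    ... | true  rewrite size≡card S =
      bound (lookup S) (isKIndep⇒IsKIndependent k G S (Equivalence.from T-≡ indep))

-- Lovász's colouring lemma

module Colouring (G : Graph) (U : Fin (order G) → Bool) (c : ℕ) where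

  Colouring : Set
  Colouring = Fin (order G) → Fin (suc c)

  sameColourAdj : Colouring → Fin (order G) → Fin (order G) → Bool
  sameColourAdj χ v w = adj G v w ∧ does (χ v ≟ χ w)

  colourDeg : Colouring → Fin (order G) → Fin (suc c) → ℕ
  colourDeg χ v i = ∑[ w < order G ] ind (U w ∧ adj G v w ∧ does (i ≟ χ w))

  monoPairs : Colouring → ℕ
  monoPairs χ = pairCount U (sameColourAdj χ)

  recolour : Colouring → Fin (order G) → Fin (suc c) → Colouring
  recolour χ v₀ i w = if does (w ≟ v₀) then i else χ w

  colourDeg-sum : ∀ χ v → ∑[ i < suc c ] colourDeg χ v i ≡ inducedDeg G U v
  colourDeg-sum χ v = trans (∑-comm (λ i w → ind (U w ∧ adj G v w ∧ does (i ≟ χ w))))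
    (sum-cong-≗ λ w → trans (sum-cong-≗ λ i → cong ind (sym (∧-assoc (U w) (adj G v w) (does (i ≟ χ w)))))
                            (∑-ind-∧-δ (U w ∧ adj G v w) (χ w)))

  monoPairs-recolour : ∀ χ v₀ i → U v₀ ≡ true →
    monoPairs χ + 2 * colourDeg χ v₀ i ≡ monoPairs (recolour χ v₀ i) + 2 * colourDeg χ v₀ (χ v₀)
  monoPairs-recolour χ v₀ i U∋v₀ = begin
    monoPairs χ + 2 * colourDeg χ v₀ i
      ≡⟨ cong (_+ 2 * colourDeg χ v₀ i) (split χ) ⟩
    rest χ + 2 * colourDeg χ v₀ (χ v₀) + 2 * colourDeg χ v₀ i
      ≡⟨ +-assoc (rest χ) _ _ ⟩
    rest χ + (2 * colourDeg χ v₀ (χ v₀) + 2 * colourDeg χ v₀ i)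
      ≡⟨ cong₂ _+_ rest-unchanged
           (trans (+-comm (2 * colourDeg χ v₀ (χ v₀)) _) (cong (λ x → 2 * x + _) colourDeg-unchanged)) ⟩
    rest χ′ + (2 * colourDeg χ′ v₀ (χ′ v₀) + 2 * colourDeg χ v₀ (χ v₀))
      ≡⟨ +-assoc (rest χ′) _ _ ⟨
    rest χ′ + 2 * colourDeg χ′ v₀ (χ′ v₀) + 2 * colourDeg χ v₀ (χ v₀)
      ≡⟨ cong (_+ 2 * colourDeg χ v₀ (χ v₀)) (split χ′) ⟨
    monoPairs χ′ + 2 * colourDeg χ v₀ (χ v₀) ∎
    where
    open ≡-Reasoning
    χ′ = recolour χ v₀ i
    rest : Colouring → ℕ
    rest κ = pairCount (U ∖ v₀) (sameColourAdj κ)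
    split : ∀ κ → monoPairs κ ≡ rest κ + 2 * colourDeg κ v₀ (κ v₀)
    split κ = pairCount-remove U∋v₀ (cong (_∧ _) (adj-irr G v₀))
      (λ v w → cong₂ _∧_ (adj-sym G v w) (does-≟-sym (κ v) (κ w)))
    χ′≗χ : ∀ w → (U ∖ v₀) w ≡ true → χ′ w ≡ χ w
    χ′≗χ w _ with w ≟ v₀
    χ′≗χ w () | yes _
    ... | no _ = refl
    rest-unchanged : rest χ ≡ rest χ′
    rest-unchanged = pairCount-cong λ v w U′∋v U′∋w →
      cong (λ b → adj G v w ∧ b) (sym (cong₂ (λ x y → does (x ≟ y)) (χ′≗χ v U′∋v) (χ′≗χ w U′∋w)))
    χ′v₀≡i : χ′ v₀ ≡ i
    χ′v₀≡i rewrite dec-true (v₀ ≟ v₀) refl = refl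
    colourDeg-unchanged : colourDeg χ v₀ i ≡ colourDeg χ′ v₀ (χ′ v₀)
    colourDeg-unchanged = trans (sum-cong-≗ term) (cong (colourDeg χ′ v₀) (sym χ′v₀≡i))
      where
      term : ∀ w → ind (U w ∧ adj G v₀ w ∧ does (i ≟ χ w)) ≡ ind (U w ∧ adj G v₀ w ∧ does (i ≟ χ′ w))
      term w with w ≟ v₀
      ... | yes refl rewrite adj-irr G w | ∧-comm (U w) false = refl
      ... | no _     = refl

  IsProper : ℕ → Colouring → Set
  IsProper k χ = ∀ v → U v ≡ true → colourDeg χ v (χ v) ≤ k

  module _ {k : ℕ} (lowDeg : ∀ v → U v ≡ true → inducedDeg G U v < suc k * suc c) where

    sparseColour : ∀ χ v → U v ≡ true → ∃ λ i → colourDeg χ v i ≤ k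
    sparseColour χ v U∋v with ∑-≥-min (colourDeg χ v)
    ... | i , bound = i , ≤-pred (*-cancelˡ-< (suc c) _ (suc k) (begin-strict
      suc c * colourDeg χ v i   ≤⟨ bound ⟩
      ∑[ j < suc c ] colourDeg χ v j ≡⟨ colourDeg-sum χ v ⟩
      inducedDeg G U v          <⟨ lowDeg v U∋v ⟩
      suc k * suc c             ≡⟨ *-comm (suc k) (suc c) ⟩
      suc c * suc k             ∎))
      where open ≤-Reasoning

    -- Moving a vertex with more than k neighbours of its own colour to its sparsest colour
    -- strictly decreases the number of monochromatic adjacent pairs.
    properColouring : ∀ χ → Acc _<_ (monoPairs χ) → ∃ (IsProper k)
    properColouring χ (acc rec) with any? (λ v → (U v ≟ᵇ true) ×-dec (k <? colourDeg χ v (χ v)))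
    ... | no noConflict = χ , λ v U∋v → ≮⇒≥ (λ k< → noConflict (v , U∋v , k<))
    ... | yes (v₀ , U∋v₀ , k<mono) with sparseColour χ v₀ U∋v₀
    ...   | i , sparse = properColouring (recolour χ v₀ i) (rec decrease)
      where
      open ≤-Reasoning
      decrease : monoPairs (recolour χ v₀ i) < monoPairs χ
      decrease = +-cancelʳ-< (2 * colourDeg χ v₀ (χ v₀)) _ _ (begin-strict
        monoPairs (recolour χ v₀ i) + 2 * colourDeg χ v₀ (χ v₀) ≡⟨ monoPairs-recolour χ v₀ i U∋v₀ ⟨
        monoPairs χ + 2 * colourDeg χ v₀ i                    <⟨ +-monoʳ-< (monoPairs χ)
                                                                  (*-monoʳ-< 2 (≤-<-trans sparse k<mono)) ⟩
        monoPairs χ + 2 * colourDeg χ v₀ (χ v₀)                ∎)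

  colourClass : Colouring → Fin (suc c) → Fin (order G) → Bool
  colourClass χ i w = U w ∧ does (i ≟ χ w)

  ∑-card-colourClass : ∀ χ → ∑[ i < suc c ] card (colourClass χ i) ≡ card U
  ∑-card-colourClass χ = trans (∑-comm (λ i w → ind (U w ∧ does (i ≟ χ w))))
                               (sum-cong-≗ λ w → ∑-ind-∧-δ (U w) (χ w))

  colourClass-indep : ∀ {k χ} → IsProper k χ → ∀ i → IsKIndependent G k (colourClass χ i)
  colourClass-indep {k} {χ} proper i v inClass with U v in U∋v | i ≟ χ v
  ... | true | yes refl =
    subst (_≤ k) (sum-cong-≗ λ w → cong ind (reorder (U w) (adj G v w) (does (i ≟ χ w)))) (proper v U∋v)
    where
    reorder : ∀ a b c → a ∧ b ∧ c ≡ (a ∧ c) ∧ b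
    reorder a b c = trans (cong (a ∧_) (∧-comm b c)) (sym (∧-assoc a c b))

  lovász : ∀ {k} → (∀ v → U v ≡ true → inducedDeg G U v < suc k * suc c) →
    ∃ λ S → IsKIndependent G k S × card U ≤ suc c * card S
  lovász lowDeg with properColouring lowDeg (λ _ → zero) (<-wellFounded _)
  ... | χ , proper with ∑-≤-max (card ∘ colourClass χ)
  ...   | i , bound = colourClass χ i , colourClass-indep proper i ,
                      subst (_≤ suc c * card (colourClass χ i)) (∑-card-colourClass χ) bound

-- The weighted lower bound on α_k

module _ (a c u s d deg : ℕ) where
  open ≤-Reasoning

  ≤-after-removal : 2 * a * suc c * u ≤ a * suc c * suc (suc c) * s + d → a * suc c ≤ deg →
    2 * a * suc c * suc u ≤ a * suc c * suc (suc c) * s + (d + 2 * deg)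
  ≤-after-removal bound highDeg = begin
    2 * a * suc c * suc u                                 ≡⟨ solve (a ∷ c ∷ u ∷ []) ⟩
    2 * a * suc c * u + 2 * (a * suc c)                   ≤⟨ +-mono-≤ bound (*-monoʳ-≤ 2 highDeg) ⟩
    a * suc c * suc (suc c) * s + d + 2 * deg             ≡⟨ +-assoc (a * suc c * suc (suc c) * s) d (2 * deg) ⟩
    a * suc c * suc (suc c) * s + (d + 2 * deg)           ∎

module _ (a c u s₁ s₂ s d : ℕ) where
  open ≤-Reasoning

  ≤-after-colouring : 2 * a * c * u ≤ a * c * suc c * s₁ + d → u ≤ suc c * s₂ → s₁ ≤ s → s₂ ≤ s →
    2 * a * suc c * u ≤ a * suc c * suc (suc c) * s + d
  ≤-after-colouring bound₁ bound₂ s₁≤s s₂≤s = begin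
    2 * a * suc c * u                                    ≡⟨ solve (a ∷ c ∷ u ∷ []) ⟩
    2 * a * c * u + 2 * a * u                            ≤⟨ +-mono-≤ bound₁ (*-monoʳ-≤ (2 * a) bound₂) ⟩
    a * c * suc c * s₁ + d + 2 * a * (suc c * s₂)        ≤⟨ +-mono-≤ (+-monoˡ-≤ d (*-monoʳ-≤ (a * c * suc c) s₁≤s))
                                                                     (*-monoʳ-≤ (2 * a) (*-monoʳ-≤ (suc c) s₂≤s)) ⟩
    a * c * suc c * s + d + 2 * a * (suc c * s)          ≡⟨ solve (a ∷ c ∷ s ∷ d ∷ []) ⟩
    a * suc c * suc (suc c) * s + d                      ∎

module _ (G : Graph) (k : ℕ) where

  LargeIndependentSet : ℕ → (Fin (order G) → Bool) → Set
  LargeIndependentSet c U = ∃ λ S → IsKIndependent G k S ×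
    2 * suc k * c * card U ≤ suc k * c * suc c * card S + inducedDegSum G U

  -- Induction on c; at c + 1 either some vertex of U has degree ≥ (k+1)(c+1) in G[U] and is
  -- deleted, or Lovász's colouring applies and is played off against the bound for c.
  largeIndependentSet : ∀ c U → LargeIndependentSet c U
  largeIndependentSet zero U =
    (λ _ → false) , (λ _ ()) , ≤-trans (≤-reflexive (cong (_* card U) (*-zeroʳ (2 * suc k)))) z≤n
  largeIndependentSet (suc c) U = step U (<-wellFounded (card U))
    where
    step : ∀ U → Acc _<_ (card U) → LargeIndependentSet (suc c) U
    step U (acc rec) with any? (λ v → (U v ≟ᵇ true) ×-dec (suc k * suc c ≤? inducedDeg G U v))
    ... | yes (v₀ , U∋v₀ , highDeg) with step (U ∖ v₀) (rec (≤-reflexive (sym (card-remove U v₀ U∋v₀))))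
    ...   | S , indep , bound = S , indep ,
      subst₂ (λ u d → 2 * suc k * suc c * u ≤ suc k * suc c * suc (suc c) * card S + d)
             (sym (card-remove U v₀ U∋v₀)) (sym (inducedDegSum-remove G U v₀ U∋v₀))
             (≤-after-removal (suc k) c _ (card S) _ _ bound highDeg)
    step U _ | no noHighDeg
      with largeIndependentSet c U | Colouring.lovász G U c (λ v U∋v → ≰⇒> (λ high → noHighDeg (v , U∋v , high)))
    ... | S₁ , indep₁ , bound₁ | S₂ , indep₂ , bound₂ with ≤-total (card S₁) (card S₂)
    ...   | inj₁ S₁≤S₂ = S₂ , indep₂ , ≤-after-colouring (suc k) c _ _ _ _ _ bound₁ bound₂ S₁≤S₂ ≤-refl
    ...   | inj₂ S₂≤S₁ = S₁ , indep₁ , ≤-after-colouring (suc k) c _ _ _ _ _ bound₁ bound₂ ≤-refl S₂≤S₁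

card-all : ∀ m → card {m} (λ _ → true) ≡ m
card-all m = trans (∑-const m 1) (*-identityʳ m)

α-weightedBound : ∀ k c G → 2 * suc k * c * n G ≤ suc k * c * suc c * α k G + degSum G
α-weightedBound k c G with largeIndependentSet G k c (λ _ → true)
... | S , indep , bound = begin
  2 * suc k * c * n G                                                 ≡⟨ cong (2 * suc k * c *_) (card-all (n G)) ⟨
  2 * suc k * c * card {n G} (λ _ → true)                             ≤⟨ bound ⟩
  suc k * c * suc c * card S + inducedDegSum G (λ _ → true)           ≤⟨ +-mono-≤
    (*-monoʳ-≤ (suc k * c * suc c) (α-greatest G S indep)) (≤-reflexive (sym (degSum≡inducedDegSum G))) ⟩
  suc k * c * suc c * α k G + degSum G                                ∎
  where open ≤-Reasoning

-- The case k = 1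

parity : ∀ d → ∃ λ j → d ≡ 2 * j ⊎ d ≡ suc (2 * j)
parity zero = 0 , inj₁ refl
parity (suc d) with parity d
... | j , inj₁ d≡2j  = j , inj₂ (cong suc d≡2j)
... | j , inj₂ d≡2j+1 = suc j , inj₁ (trans (cong suc d≡2j+1) (sym (*-suc 2 j)))

α₁-residualBound : ∀ G j r s → degSum G ≤ r * n G → r + s ≡ 4 * suc j →
  s * n G ≤ 2 * suc j * suc (suc j) * α 1 G
α₁-residualBound G j r s sparse r+s≡ = +-cancelˡ-≤ (r * n G) _ _ (begin
  r * n G + s * n G                               ≡⟨ *-distribʳ-+ (n G) r s ⟨
  (r + s) * n G                                   ≡⟨ cong (_* n G) r+s≡ ⟩
  4 * suc j * n G                                 ≤⟨ α-weightedBound 1 (suc j) G ⟩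
  2 * suc j * suc (suc j) * α 1 G + degSum G      ≤⟨ +-monoʳ-≤ _ sparse ⟩
  2 * suc j * suc (suc j) * α 1 G + r * n G       ≡⟨ +-comm _ (r * n G) ⟩
  r * n G + 2 * suc j * suc (suc j) * α 1 G       ∎)
  where open ≤-Reasoning

α₁-bound-even : ∀ G j → degSum G ≤ 2 * j * n G → (4 + 2 * j) * n G ≤ 2 * suc j * suc (suc j) * α 1 G
α₁-bound-even G j sparse = α₁-residualBound G j _ _ sparse (split j)
  where
  split : ∀ j → 2 * j + (4 + 2 * j) ≡ 4 * suc j
  split = solve-∀

α₁-bound-odd : ∀ G j → degSum G ≤ suc (2 * j) * n G → (3 + 2 * j) * n G ≤ 2 * suc j * suc (suc j) * α 1 G
α₁-bound-odd G j sparse = α₁-residualBound G j _ _ sparse (split j)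
  where
  split : ∀ j → suc (2 * j) + (3 + 2 * j) ≡ 4 * suc j
  split = solve-∀

module _ (j a x : ℕ) where
  open ≤-Reasoning

  ≤-even : (4 + 2 * j) * x ≤ 2 * suc j * suc (suc j) * a → 2 * x ≤ a * (2 + 2 * j)
  ≤-even bound = *-cancelˡ-≤ (suc (suc j)) (begin
    suc (suc j) * (2 * x)              ≡⟨ solve (j ∷ x ∷ []) ⟩
    (4 + 2 * j) * x                    ≤⟨ bound ⟩
    2 * suc j * suc (suc j) * a        ≡⟨ solve (j ∷ a ∷ []) ⟩
    suc (suc j) * (a * (2 + 2 * j))    ∎)

  ≤-odd : (3 + 2 * j) * x ≤ 2 * suc j * suc (suc j) * a → 2 * (3 + 2 * j) * x ≤ a * ((2 + 2 * j) * (4 + 2 * j))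
  ≤-odd bound = begin
    2 * (3 + 2 * j) * x                ≡⟨ *-assoc 2 (3 + 2 * j) x ⟩
    2 * ((3 + 2 * j) * x)              ≤⟨ *-monoʳ-≤ 2 bound ⟩
    2 * (2 * suc j * suc (suc j) * a)  ≡⟨ solve (j ∷ a ∷ []) ⟩
    a * ((2 + 2 * j) * (4 + 2 * j))    ∎

  -- (2j+2)(2j+4) + 1 = (2j+3)²
  ≤-odd-weak : (3 + 2 * j) * x ≤ 2 * suc j * suc (suc j) * a → 2 * x ≤ a * (3 + 2 * j)
  ≤-odd-weak bound = *-cancelˡ-≤ (3 + 2 * j) (begin
    (3 + 2 * j) * (2 * x)              ≡⟨ solve (j ∷ x ∷ []) ⟩
    2 * (3 + 2 * j) * x                ≤⟨ ≤-odd bound ⟩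
    a * ((2 + 2 * j) * (4 + 2 * j))    ≤⟨ m≤m+n _ a ⟩
    a * ((2 + 2 * j) * (4 + 2 * j)) + a ≡⟨ solve (j ∷ a ∷ []) ⟩
    (3 + 2 * j) * (a * (3 + 2 * j))    ∎)

α₁-lowerBound-odd : ∀ G {d} j → d ≡ suc (2 * j) →
  degSum G ≤ d * n G → 2 * (2 + d) * n G ≤ α 1 G * ((1 + d) * (3 + d))
α₁-lowerBound-odd G j refl sparse = ≤-odd j (α 1 G) (n G) (α₁-bound-odd G j sparse)

α₁-lowerBound : ∀ G d → degSum G ≤ d * n G → 2 * n G ≤ α 1 G * (2 + d)
α₁-lowerBound G d sparse with parity d
... | j , inj₁ refl = ≤-even j (α 1 G) (n G) (α₁-bound-even G j sparse)
... | j , inj₂ refl = ≤-odd-weak j (α 1 G) (n G) (α₁-bound-odd G j sparse)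

-- The extremal graphs

∑-↑ : ∀ a b (f : Fin (a + b) → ℕ) → ∑[ i < a + b ] f i ≡ ∑[ i < a ] f (i ↑ˡ b) + ∑[ i < b ] f (a ↑ʳ i)
∑-↑ zero    b f = refl
∑-↑ (suc a) b f = trans (cong (λ x → f zero + x) (∑-↑ a b (f ∘ suc))) (sym (+-assoc (f zero) _ _))

module _ (G H : Graph) where

  private
    a = order G
    b = order H

  adj-↑ˡ-↑ˡ : ∀ x y → adj (G ∪ H) (x ↑ˡ b) (y ↑ˡ b) ≡ adj G x y
  adj-↑ˡ-↑ˡ x y rewrite splitAt-↑ˡ a x b | splitAt-↑ˡ a y b = refl

  adj-↑ˡ-↑ʳ : ∀ x y → adj (G ∪ H) (x ↑ˡ b) (a ↑ʳ y) ≡ false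
  adj-↑ˡ-↑ʳ x y rewrite splitAt-↑ˡ a x b | splitAt-↑ʳ a b y = refl

  adj-↑ʳ-↑ˡ : ∀ x y → adj (G ∪ H) (a ↑ʳ x) (y ↑ˡ b) ≡ false
  adj-↑ʳ-↑ˡ x y rewrite splitAt-↑ʳ a b x | splitAt-↑ˡ a y b = refl

  adj-↑ʳ-↑ʳ : ∀ x y → adj (G ∪ H) (a ↑ʳ x) (a ↑ʳ y) ≡ adj H x y
  adj-↑ʳ-↑ʳ x y rewrite splitAt-↑ʳ a b x | splitAt-↑ʳ a b y = refl

  inducedDeg-↑ˡ : ∀ S x → inducedDeg (G ∪ H) S (x ↑ˡ b) ≡ inducedDeg G (S ∘ (_↑ˡ b)) x
  inducedDeg-↑ˡ S x = begin
    inducedDeg (G ∪ H) S (x ↑ˡ b)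
      ≡⟨ ∑-↑ a b _ ⟩
    ∑[ i < a ] ind (S (i ↑ˡ b) ∧ adj (G ∪ H) (x ↑ˡ b) (i ↑ˡ b))
      + ∑[ i < b ] ind (S (a ↑ʳ i) ∧ adj (G ∪ H) (x ↑ˡ b) (a ↑ʳ i))
      ≡⟨ cong₂ _+_ (sum-cong-≗ λ i → cong (λ e → ind (S (i ↑ˡ b) ∧ e)) (adj-↑ˡ-↑ˡ x i))
                   (sum-cong-≗ λ i → cong ind (trans (cong (S (a ↑ʳ i) ∧_) (adj-↑ˡ-↑ʳ x i)) (∧-zeroʳ _))) ⟩
    inducedDeg G (S ∘ (_↑ˡ b)) x + ∑[ i < b ] 0
      ≡⟨ cong (λ z → inducedDeg G (S ∘ (_↑ˡ b)) x + z) (sum-replicate-zero b) ⟩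
    inducedDeg G (S ∘ (_↑ˡ b)) x + 0
      ≡⟨ +-identityʳ _ ⟩
    inducedDeg G (S ∘ (_↑ˡ b)) x ∎
    where open ≡-Reasoning

  inducedDeg-↑ʳ : ∀ S y → inducedDeg (G ∪ H) S (a ↑ʳ y) ≡ inducedDeg H (S ∘ (a ↑ʳ_)) y
  inducedDeg-↑ʳ S y = begin
    inducedDeg (G ∪ H) S (a ↑ʳ y)
      ≡⟨ ∑-↑ a b _ ⟩
    ∑[ i < a ] ind (S (i ↑ˡ b) ∧ adj (G ∪ H) (a ↑ʳ y) (i ↑ˡ b))
      + ∑[ i < b ] ind (S (a ↑ʳ i) ∧ adj (G ∪ H) (a ↑ʳ y) (a ↑ʳ i))
      ≡⟨ cong₂ _+_ (sum-cong-≗ λ i → cong ind (trans (cong (S (i ↑ˡ b) ∧_) (adj-↑ʳ-↑ˡ y i)) (∧-zeroʳ _)))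
                   (sum-cong-≗ λ i → cong (λ e → ind (S (a ↑ʳ i) ∧ e)) (adj-↑ʳ-↑ʳ y i)) ⟩
    ∑[ i < a ] 0 + inducedDeg H (S ∘ (a ↑ʳ_)) y
      ≡⟨ cong (_+ inducedDeg H (S ∘ (a ↑ʳ_)) y) (sum-replicate-zero a) ⟩
    inducedDeg H (S ∘ (a ↑ʳ_)) y ∎
    where open ≡-Reasoning

  α-∪ : ∀ k → α k (G ∪ H) ≤ α k G + α k H
  α-∪ k = α-least (G ∪ H) λ S indep → begin
    card S                                  ≡⟨ ∑-↑ a b (ind ∘ S) ⟩
    card (S ∘ (_↑ˡ b)) + card (S ∘ (a ↑ʳ_)) ≤⟨ +-mono-≤
      (α-greatest G _ λ x S∋x → subst (_≤ k) (inducedDeg-↑ˡ S x) (indep (x ↑ˡ b) S∋x))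
      (α-greatest H _ λ y S∋y → subst (_≤ k) (inducedDeg-↑ʳ S y) (indep (a ↑ʳ y) S∋y)) ⟩
    α k G + α k H                           ∎
    where open ≤-Reasoning

  degSum-∪ : degSum (G ∪ H) ≡ degSum G + degSum H
  degSum-∪ = begin
    degSum (G ∪ H)
      ≡⟨ degSum≡inducedDegSum (G ∪ H) ⟩
    ∑[ v < a + b ] inducedDeg (G ∪ H) all v
      ≡⟨ ∑-↑ a b _ ⟩
    ∑[ x < a ] inducedDeg (G ∪ H) all (x ↑ˡ b) + ∑[ y < b ] inducedDeg (G ∪ H) all (a ↑ʳ y)
      ≡⟨ cong₂ _+_ (sum-cong-≗ (inducedDeg-↑ˡ all)) (sum-cong-≗ (inducedDeg-↑ʳ all)) ⟩
    inducedDegSum G all + inducedDegSum H all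
      ≡⟨ cong₂ _+_ (degSum≡inducedDegSum G) (degSum≡inducedDegSum H) ⟨
    degSum G + degSum H ∎
    where
    open ≡-Reasoning
    all : ∀ {m} → Fin m → Bool
    all _ = true

order-copies : ∀ q F → order (copies q F) ≡ q * order F
order-copies zero    F = refl
order-copies (suc q) F = cong (λ x → order F + x) (order-copies q F)

α-copies : ∀ k q F → α k (copies q F) ≤ q * α k F
α-copies k zero    F = z≤n
α-copies k (suc q) F = ≤-trans (α-∪ F (copies q F) k) (+-monoʳ-≤ (α k F) (α-copies k q F))

degSum-copies : ∀ q F → degSum (copies q F) ≡ q * degSum F
degSum-copies zero    F = refl
degSum-copies (suc q) F = trans (degSum-∪ F (copies q F)) (cong (λ x → degSum F + x) (degSum-copies q F))

blockSize : ∀ t h → ∑[ u < 2 * t ] ind (h ≡ᵇ toℕ u ℕ./ 2) ≡ (if h <ᵇ t then 2 else 0)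
blockSize zero    h = refl
blockSize (suc t) h = trans (cong (λ m → ∑[ u < m ] ind (h ≡ᵇ toℕ u ℕ./ 2)) (*-suc 2 t)) (twoMore h)
  where
  twoMore : ∀ h → ∑[ u < suc (suc (2 * t)) ] ind (h ≡ᵇ toℕ u ℕ./ 2) ≡ (if h <ᵇ suc t then 2 else 0)
  twoMore h = trans (cong (λ rest → ind (h ≡ᵇ 0) + (ind (h ≡ᵇ 0) + rest)) tailBlocks) (shift h)
    where
    tailBlocks : ∑[ u < 2 * t ] ind (h ≡ᵇ (2 + toℕ u) ℕ./ 2) ≡ ∑[ u < 2 * t ] ind (h ≡ᵇ suc (toℕ u ℕ./ 2))
    tailBlocks = sum-cong-≗ half
      where
      half : ∀ (u : Fin (2 * t)) → ind (h ≡ᵇ (2 + toℕ u) ℕ./ 2) ≡ ind (h ≡ᵇ suc (toℕ u ℕ./ 2))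
      half u = cong (λ b → ind (h ≡ᵇ b)) (m/n≡1+[m∸n]/n {2 + toℕ u} {2} (s≤s (s≤s z≤n)))
    shift : ∀ h → ind (h ≡ᵇ 0) + (ind (h ≡ᵇ 0) + ∑[ u < 2 * t ] ind (h ≡ᵇ suc (toℕ u ℕ./ 2)))
                  ≡ (if h <ᵇ suc t then 2 else 0)
    shift zero    = cong (λ x → 2 + x) (sum-replicate-zero (2 * t))
    shift (suc h) = blockSize t h

≡ᵇ-true : ∀ {x y} → (x ≡ᵇ y) ≡ true → x ≡ y
≡ᵇ-true {x} {y} = ≡ᵇ⇒≡ x y ∘ Equivalence.from T-≡

module _ {m : ℕ} (t : ℕ) (m≡2t : m ≡ 2 * t) where

  block : Fin m → ℕ
  block u = toℕ u ℕ./ 2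

  block< : ∀ v → block v < t
  block< v = m<n*o⇒m/o<n (subst (toℕ v <_) (trans m≡2t (*-comm 2 t)) (toℕ<n v))

  blockSize′ : ∀ h → ∑[ u < m ] ind (h ≡ᵇ block u) ≡ (if h <ᵇ t then 2 else 0)
  blockSize′ h = trans (cong (λ k → ∑[ u < k ] ind (h ≡ᵇ toℕ u ℕ./ 2)) m≡2t) (blockSize t h)

  blockSize-≤ : ∀ h → ∑[ u < m ] ind (h ≡ᵇ block u) ≤ 2
  blockSize-≤ h rewrite blockSize′ h with h <ᵇ t
  ... | true  = ≤-refl
  ... | false = z≤n

  blockSize-block : ∀ v → ∑[ u < m ] ind (block v ≡ᵇ block u) ≡ 2
  blockSize-block v rewrite blockSize′ (block v) | Equivalence.to T-≡ (<⇒<ᵇ (block< v)) = refl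

  deg-J : ∀ v → 2 + deg (J m) v ≡ m
  deg-J v = begin
    2 + deg (J m) v
      ≡⟨ cong₂ _+_ (sym (blockSize-block v)) (count≡∑ (adj (J m) v)) ⟩
    ∑[ u < m ] ind (same u) + ∑[ u < m ] ind (not (same u))
      ≡⟨ ∑-distrib-+ (ind ∘ same) (ind ∘ not ∘ same) ⟨
    ∑[ u < m ] (ind (same u) + ind (not (same u)))
      ≡⟨ sum-cong-≗ (λ u → one (same u)) ⟩
    ∑[ u < m ] 1
      ≡⟨ trans (∑-const m 1) (*-identityʳ m) ⟩
    m ∎
    where
    open ≡-Reasoning
    same : Fin m → Bool
    same u = block v ≡ᵇ block u
    one : ∀ b → ind b + ind (not b) ≡ 1
    one true  = refl
    one false = refl

  adj-J⇒≢ : ∀ {v w} → adj (J m) v w ≡ true → block v ≢ block w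
  adj-J⇒≢ {v} {w} v~w v≈w rewrite Equivalence.to T-≡ (≡⇒≡ᵇ _ _ v≈w) with v~w
  ... | ()

  sameBlockIn : (Fin m → Bool) → Fin m → ℕ
  sameBlockIn S v = ∑[ u < m ] ind (S u ∧ (block v ≡ᵇ block u))

  card-split : ∀ S v → card S ≡ sameBlockIn S v + inducedDeg (J m) S v
  card-split S v = trans (sum-cong-≗ λ u → split (S u) (block v ≡ᵇ block u))
                         (∑-distrib-+ (λ u → ind (S u ∧ (block v ≡ᵇ block u))) (λ u → ind (S u ∧ adj (J m) v u)))
    where
    split : ∀ s b → ind s ≡ ind (s ∧ b) + ind (s ∧ not b)
    split true  true  = refl
    split true  false = refl
    split false _     = refl

  sameBlockIn-≤ : ∀ S v → sameBlockIn S v ≤ 2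
  sameBlockIn-≤ S v = ≤-trans (∑-mono-≤ λ u → restrict (S u) (block v ≡ᵇ block u)) (blockSize-≤ (block v))
    where
    restrict : ∀ s b → ind (s ∧ b) ≤ ind b
    restrict true  _ = ≤-refl
    restrict false _ = z≤n

  sameBlockIn-≤-inducedDeg : ∀ S v w → block v ≢ block w → sameBlockIn S v ≤ inducedDeg (J m) S w
  sameBlockIn-≤-inducedDeg S v w v≁w = ∑-mono-≤ point
    where
    point : ∀ u → ind (S u ∧ (block v ≡ᵇ block u)) ≤ ind (S u ∧ not (block w ≡ᵇ block u))
    point u with S u | block v ≡ᵇ block u in vu | block w ≡ᵇ block u in wu
    ... | false | _     | _     = z≤n
    ... | true  | false | _     = z≤n
    ... | true  | true  | false = ≤-refl
    ... | true  | true  | true  = contradiction (trans (≡ᵇ-true vu) (sym (≡ᵇ-true wu))) v≁w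

  -- If |S| ≥ 3, a vertex v of S has at most one neighbour in S, so S also contains the partner
  -- of v and a neighbour w of v; but w is adjacent to both v and its partner.
  oneIndependent-card-≤-2 : ∀ S → IsKIndependent (J m) 1 S → card S ≤ 2
  oneIndependent-card-≤-2 S indep with card S ≤? 2
  ... | yes small = small
  ... | no  large with ∑-ind-witness S (≤-trans (s≤s z≤n) (≰⇒> large))
  ...   | v , S∋v with ∑-ind-witness (λ u → S u ∧ adj (J m) v u) deg≥1
    where
    deg≥1 : 1 ≤ inducedDeg (J m) S v
    deg≥1 = +-cancelˡ-≤ 2 1 _ (≤-trans (≰⇒> large)
              (≤-trans (≤-reflexive (card-split S v)) (+-monoˡ-≤ _ (sameBlockIn-≤ S v))))
  ...     | w , v~w = contradiction (begin
    2                          ≤⟨ same≥2 ⟩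
    sameBlockIn S v            ≤⟨ sameBlockIn-≤-inducedDeg S v w (adj-J⇒≢ {v} {w} (∧-conicalʳ (S w) _ v~w)) ⟩
    inducedDeg (J m) S w       ≤⟨ indep w (∧-conicalˡ (S w) _ v~w) ⟩
    1                          ∎) λ { (s≤s ()) }
    where
    open ≤-Reasoning
    same≥2 : 2 ≤ sameBlockIn S v
    same≥2 = +-cancelʳ-≤ 1 2 _ (≤-trans (≰⇒> large)
               (≤-trans (≤-reflexive (card-split S v)) (+-monoʳ-≤ _ (indep v S∋v))))

  α-J : α 1 (J m) ≤ 2
  α-J = α-least (J m) oneIndependent-card-≤-2

  degSum-J : ∀ {e} → 2 + e ≡ m → degSum (J m) ≡ m * e
  degSum-J {e} 2+e≡m = begin
    degSum (J m)             ≡⟨ sum-map-allFin m (deg (J m)) ⟩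
    ∑[ v < m ] deg (J m) v   ≡⟨ sum-cong-≗ (λ v → +-cancelˡ-≡ 2 _ _ (trans (deg-J v) (sym 2+e≡m))) ⟩
    ∑[ v < m ] e             ≡⟨ ∑-const m e ⟩
    m * e                    ∎
    where open ≡-Reasoning

-- With the denominators written as suc b and suc e, + a / suc b unfolds to fromℚᵘ (mkℚᵘ (+ a) b).
*≤*⇒/≤/ : ∀ a b c e .{{_ : NonZero b}} .{{_ : NonZero e}} → a * e ≤ c * b → + a / b ℚ.≤ + c / e
*≤*⇒/≤/ a (suc b) c (suc e) ae≤cb = ℚ.toℚᵘ-cancel-≤
  (ℚᵘ.≤-respˡ-≃ (ℚᵘ.≃-sym (ℚ.toℚᵘ-fromℚᵘ (mkℚᵘ (+ a) b)))
  (ℚᵘ.≤-respʳ-≃ (ℚᵘ.≃-sym (ℚ.toℚᵘ-fromℚᵘ (mkℚᵘ (+ c) e)))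
  (*≤* (subst₂ ℤ._≤_ (ℤ.pos-* a (suc e)) (ℤ.pos-* c (suc b)) (ℤ.+≤+ ae≤cb)))))

/≤/⇒*≤* : ∀ a b c e .{{_ : NonZero b}} .{{_ : NonZero e}} → + a / b ℚ.≤ + c / e → a * e ≤ c * b
/≤/⇒*≤* a (suc b) c (suc e) a/b≤c/e
  with ℚᵘ.≤-respˡ-≃ (ℚ.toℚᵘ-fromℚᵘ (mkℚᵘ (+ a) b))
         (ℚᵘ.≤-respʳ-≃ (ℚ.toℚᵘ-fromℚᵘ (mkℚᵘ (+ c) e)) (ℚ.toℚᵘ-mono-≤ a/b≤c/e))
... | *≤* ae≤cb = ℤ.drop‿+≤+ (subst₂ ℤ._≤_ (sym (ℤ.pos-* a (suc e))) (sym (ℤ.pos-* c (suc b))) ae≤cb)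

*≡*⇒/≡/ : ∀ a b c e .{{_ : NonZero b}} .{{_ : NonZero e}} → a * e ≡ c * b → + a / b ≡ + c / e
*≡*⇒/≡/ a b c e ae≡cb =
  ℚ.≤-antisym (*≤*⇒/≤/ a b c e (≤-reflexive ae≡cb)) (*≤*⇒/≤/ c e a b (≤-reflexive (sym ae≡cb)))

floor*↧≤↥ : ∀ q → floor q ℤ.* ↧ q ℤ.≤ ↥ q
floor*↧≤↥ (mkℚ n d _) = [n/d]*d≤n n (+ suc d)

↥≤ceiling*↧ : ∀ q → ↥ q ℤ.≤ ceiling q ℤ.* ↧ q
↥≤ceiling*↧ q@record{} = begin
  ↥ q                             ≡⟨ ℤ.neg-involutive (↥ q) ⟨
  ℤ.- (ℤ.- ↥ q)                   ≤⟨ ℤ.neg-mono-≤ (subst₂ (λ d n → floor (ℚ.- q) ℤ.* d ℤ.≤ n)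
                                          (ℚ.↧-neg q) (ℚ.↥-neg q) (floor*↧≤↥ (ℚ.- q))) ⟩
  ℤ.- (floor (ℚ.- q) ℤ.* ↧ q)     ≡⟨ ℤ.neg-distribˡ-* (floor (ℚ.- q)) (↧ q) ⟩
  ceiling q ℤ.* ↧ q               ∎
  where open ℤ.≤-Reasoning

ceiling-/ : ∀ s m .{{_ : NonZero m}} → ∃ λ D → ceiling (+ s / m) ≡ + D × s ≤ D * m
ceiling-/ s m@(suc _) with ceiling (+ s / m) in ceiling≡ | s≤ceiling*m
  where
  s≤ceiling*m : + s ℤ.≤ ceiling (+ s / m) ℤ.* + m
  s≤ceiling*m = begin
    + s                                             ≡⟨ ℚ.↥-/ (+ s) m ⟨
    ↥ (+ s / m) ℤ.* gcd (+ s) (+ m)                 ≤⟨ ℤ.*-monoʳ-≤-nonNeg (gcd (+ s) (+ m)) (↥≤ceiling*↧ (+ s / m)) ⟩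
    ceiling (+ s / m) ℤ.* ↧ (+ s / m) ℤ.* gcd (+ s) (+ m)   ≡⟨ ℤ.*-assoc (ceiling (+ s / m)) _ _ ⟩
    ceiling (+ s / m) ℤ.* (↧ (+ s / m) ℤ.* gcd (+ s) (+ m)) ≡⟨ cong (ceiling (+ s / m) ℤ.*_) (ℚ.↧-/ (+ s) m) ⟩
    ceiling (+ s / m) ℤ.* + m                      ∎
    where open ℤ.≤-Reasoning
... | + D | s≤D*m = D , refl , ℤ.drop‿+≤+ (subst (+ s ℤ.≤_) (sym (ℤ.pos-* D m)) s≤D*m)

-- f(1,d)

sparse⇒degSum≤ : ∀ G d .{{_ : NonZero (n G)}} → AvgDegAtMost G d → degSum G ≤ d * n G
sparse⇒degSum≤ G d sparse =
  ≤-trans (≤-reflexive (sym (*-identityʳ (degSum G)))) (/≤/⇒*≤* (degSum G) (n G) d 1 sparse)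

degSum≤⇒sparse : ∀ G d .{{_ : NonZero (n G)}} → degSum G ≤ d * n G → AvgDegAtMost G d
degSum≤⇒sparse G d bound = *≤*⇒/≤/ (degSum G) (n G) d 1 (≤-trans (≤-reflexive (*-identityʳ (degSum G))) bound)

IsF-attained : ∀ {k d q} → IsLowerBoundF k d q →
  (G : Graph) {{_ : NonZero (n G)}} → AvgDegAtMost G d → ratio k G ≡ q → IsF k d q
IsF-attained lower G {{nz}} sparse ratio≡q =
  lower , λ q′ q<q′ → G , nz , sparse , subst (ℚ._< q′) (sym ratio≡q) q<q′

f₁-lowerBound : ∀ d → IsLowerBoundF 1 d (+ 2 / (2 + d))
f₁-lowerBound d G sparse = *≤*⇒/≤/ 2 (2 + d) (α 1 G) (n G) (α₁-lowerBound G d (sparse⇒degSum≤ G d sparse))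

f₁-lowerBound-odd : ∀ d j → d ≡ suc (2 * j) → IsLowerBoundF 1 d (+ (2 * (2 + d)) / ((1 + d) * (3 + d)))
f₁-lowerBound-odd d j d≡2j+1 G sparse =
  *≤*⇒/≤/ (2 * (2 + d)) ((1 + d) * (3 + d)) (α 1 G) (n G)
          (α₁-lowerBound-odd G j d≡2j+1 (sparse⇒degSum≤ G d sparse))

α₁-ceilingBound : (G : Graph) → .{{_ : NonZero (n G)}} →
  + (2 * n G) ℤ.≤ + α 1 G ℤ.* (ceiling (avgDeg G) ℤ.+ + 2)
α₁-ceilingBound G with ceiling-/ (degSum G) (n G)
... | D , ceiling≡D , degSum≤ rewrite ceiling≡D =
  subst (+ (2 * n G) ℤ.≤_) (ℤ.pos-* (α 1 G) (D + 2))
        (ℤ.+≤+ (≤-trans (α₁-lowerBound G D degSum≤) (≤-reflexive (cong (α 1 G *_) (+-comm 2 D)))))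

extremal-even : ∀ d j → d ≡ 2 * j →
  AvgDegAtMost (J (2 + d)) d × ratio 1 (J (2 + d)) ≡ + 2 / (2 + d)
extremal-even d j d≡2j = degSum≤⇒sparse (J m′) d (≤-reflexive degSum≡) , cong (λ a → + a / m′) α≡2
  where
  m′ = 2 + d
  m≡2t : m′ ≡ 2 * suc j
  m≡2t = trans (cong (λ x → 2 + x) d≡2j) (sym (*-suc 2 j))
  degSum≡ : degSum (J m′) ≡ d * m′
  degSum≡ = trans (degSum-J (suc j) m≡2t refl) (*-comm m′ d)
  α≡2 : α 1 (J m′) ≡ 2
  α≡2 = ≤-antisym (α-J (suc j) m≡2t)
                  (*-cancelʳ-≤ 2 (α 1 (J m′)) m′ (α₁-lowerBound (J m′) d (≤-reflexive degSum≡)))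

oddExtremal : ℕ → Graph
oddExtremal d = copies (3 + d) (J (1 + d)) ∪ copies (1 + d) (J (3 + d))

order-oddExtremal : ∀ d → n (oddExtremal d) ≡ 2 * ((1 + d) * (3 + d))
order-oddExtremal d =
  trans (cong₂ _+_ (order-copies (3 + d) (J (1 + d))) (order-copies (1 + d) (J (3 + d)))) (double d)
  where
  double : ∀ d → (3 + d) * (1 + d) + (1 + d) * (3 + d) ≡ 2 * ((1 + d) * (3 + d))
  double = solve-∀

regroup-oddExtremal : ∀ d → 4 * (2 + d) * ((1 + d) * (3 + d)) ≡ 2 * (2 + d) * n (oddExtremal d)
regroup-oddExtremal d = trans (four d) (cong (2 * (2 + d) *_) (sym (order-oddExtremal d)))
  where
  four : ∀ d → 4 * (2 + d) * ((1 + d) * (3 + d)) ≡ 2 * (2 + d) * (2 * ((1 + d) * (3 + d)))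
  four = solve-∀

module _ {d : ℕ} (j : ℕ) (d≡2j+1 : d ≡ suc (2 * j)) where

  private
    H = oddExtremal d
    1+d≡ : 1 + d ≡ 2 * suc j
    1+d≡ = trans (cong suc d≡2j+1) (sym (*-suc 2 j))
    3+d≡ : 3 + d ≡ 2 * suc (suc j)
    3+d≡ = trans (cong (λ x → 2 + x) 1+d≡) (sym (*-suc 2 (suc j)))

  degSum-oddExtremal : degSum H ≡ d * n H
  degSum-oddExtremal = begin
    degSum H
      ≡⟨ degSum-∪ (copies (3 + d) (J (1 + d))) (copies (1 + d) (J (3 + d))) ⟩
    degSum (copies (3 + d) (J (1 + d))) + degSum (copies (1 + d) (J (3 + d)))
      ≡⟨ cong₂ _+_ (trans (degSum-copies (3 + d) (J (1 + d)))
                          (cong ((3 + d) *_) (degSum-J (suc j) 1+d≡ (cong suc (sym d≡2j+1)))))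
                   (trans (degSum-copies (1 + d) (J (3 + d)))
                          (cong ((1 + d) *_) (degSum-J (suc (suc j)) 3+d≡ (cong (λ x → 3 + x) (sym d≡2j+1))))) ⟩
    (3 + d) * ((1 + d) * (2 * j)) + (1 + d) * ((3 + d) * (2 + 2 * j))
      ≡⟨ cong (λ d → (3 + d) * ((1 + d) * (2 * j)) + (1 + d) * ((3 + d) * (2 + 2 * j))) d≡2j+1 ⟩
    (4 + 2 * j) * ((2 + 2 * j) * (2 * j)) + (2 + 2 * j) * ((4 + 2 * j) * (2 + 2 * j))
      ≡⟨ degSums j ⟩
    suc (2 * j) * (2 * ((2 + 2 * j) * (4 + 2 * j)))
      ≡⟨ cong (λ d → d * (2 * ((1 + d) * (3 + d)))) d≡2j+1 ⟨
    d * (2 * ((1 + d) * (3 + d)))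
      ≡⟨ cong (d *_) (order-oddExtremal d) ⟨
    d * n H ∎
    where
    open ≡-Reasoning
    degSums : ∀ j → (4 + 2 * j) * ((2 + 2 * j) * (2 * j)) + (2 + 2 * j) * ((4 + 2 * j) * (2 + 2 * j))
                    ≡ suc (2 * j) * (2 * ((2 + 2 * j) * (4 + 2 * j)))
    degSums = solve-∀

  α₁-oddExtremal : α 1 H ≡ 4 * (2 + d)
  α₁-oddExtremal = ≤-antisym upper (*-cancelʳ-≤ (4 * (2 + d)) (α 1 H) ((1 + d) * (3 + d)) lower)
    where
    open ≤-Reasoning
    upper : α 1 H ≤ 4 * (2 + d)
    upper = begin
      α 1 H
        ≤⟨ α-∪ (copies (3 + d) (J (1 + d))) (copies (1 + d) (J (3 + d))) 1 ⟩
      α 1 (copies (3 + d) (J (1 + d))) + α 1 (copies (1 + d) (J (3 + d)))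
        ≤⟨ +-mono-≤ (≤-trans (α-copies 1 (3 + d) (J (1 + d))) (*-monoʳ-≤ (3 + d) (α-J (suc j) 1+d≡)))
                    (≤-trans (α-copies 1 (1 + d) (J (3 + d))) (*-monoʳ-≤ (1 + d) (α-J (suc (suc j)) 3+d≡))) ⟩
      (3 + d) * 2 + (1 + d) * 2
        ≡⟨ total d ⟩
      4 * (2 + d) ∎
      where
      total : ∀ d → (3 + d) * 2 + (1 + d) * 2 ≡ 4 * (2 + d)
      total = solve-∀
    lower : 4 * (2 + d) * ((1 + d) * (3 + d)) ≤ α 1 H * ((1 + d) * (3 + d))
    lower = begin
      4 * (2 + d) * ((1 + d) * (3 + d))         ≡⟨ regroup-oddExtremal d ⟩
      2 * (2 + d) * n H                         ≤⟨ α₁-lowerBound-odd H j d≡2j+1 (≤-reflexive degSum-oddExtremal) ⟩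
      α 1 H * ((1 + d) * (3 + d))               ∎

extremal-odd : ∀ d j → d ≡ suc (2 * j) →
  AvgDegAtMost (oddExtremal d) d × ratio 1 (oddExtremal d) ≡ + (2 * (2 + d)) / ((1 + d) * (3 + d))
extremal-odd d j d≡2j+1 =
  degSum≤⇒sparse (oddExtremal d) d (≤-reflexive (degSum-oddExtremal j d≡2j+1)) ,
  *≡*⇒/≡/ (α 1 (oddExtremal d)) (n (oddExtremal d)) (2 * (2 + d)) ((1 + d) * (3 + d))
          (trans (cong (_* ((1 + d) * (3 + d))) (α₁-oddExtremal j d≡2j+1)) (regroup-oddExtremal d))

even⇒ : ∀ {d} → 2 ∣ d → ∃ λ j → d ≡ 2 * j
even⇒ (divides j d≡j*2) = j , trans d≡j*2 (*-comm j 2)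

odd⇒ : ∀ {d} → ¬ 2 ∣ d → ∃ λ j → d ≡ suc (2 * j)
odd⇒ {d} ¬even with parity d
... | j , inj₁ d≡2j   = contradiction (divides j (trans d≡2j (*-comm 2 j))) ¬even
... | j , inj₂ d≡2j+1 = j , d≡2j+1

f₁-even : ∀ d → 2 ∣ d → IsF 1 d (+ 2 / (2 + d))
f₁-even d 2∣d with even⇒ 2∣d
... | j , d≡2j = uncurry (IsF-attained {d = d} (f₁-lowerBound d) (J (2 + d))) (extremal-even d j d≡2j)

f₁-odd : ∀ d → ¬ 2 ∣ d → IsF 1 d (+ (2 * (2 + d)) / ((1 + d) * (3 + d)))
f₁-odd d ¬2∣d with odd⇒ ¬2∣d
... | j , d≡2j+1 =
  uncurry (IsF-attained {d = d} (f₁-lowerBound-odd d j d≡2j+1) (oddExtremal d)) (extremal-odd d j d≡2j+1)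

theorem17 : (d : ℕ) →
    ((2 ∣ d → IsF 1 d (+ 2 / (2 + d))) ×
     (¬ (2 ∣ d) → IsF 1 d (+ (2 * (2 + d)) / ((1 + d) * (3 + d))))) ×
    ((2 ∣ d → AvgDegAtMost (J (2 + d)) d × ratio 1 (J (2 + d)) ≡ + 2 / (2 + d)) ×
     (¬ (2 ∣ d) →
       AvgDegAtMost (copies (3 + d) (J (1 + d)) ∪ copies (1 + d) (J (3 + d))) d ×
       ratio 1 (copies (3 + d) (J (1 + d)) ∪ copies (1 + d) (J (3 + d)))
         ≡ + (2 * (2 + d)) / ((1 + d) * (3 + d)))) ×
    IsLowerBoundF 1 d (+ 2 / (2 + d)) ×
    ((G : Graph) → .{{_ : NonZero (n G)}} →
      + (2 * n G) ℤ.≤ + α 1 G ℤ.* (⌈ avgDeg G ⌉ ℤ.+ + 2))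
theorem17 d =
  (f₁-even d , f₁-odd d) ,
  ((λ 2∣d → uncurry (extremal-even d) (even⇒ 2∣d)) , (λ ¬2∣d → uncurry (extremal-odd d) (odd⇒ ¬2∣d))) ,
  f₁-lowerBound d ,
  α₁-ceilingBound
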